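{- Let $D$ be an FDAG with vertices $v_0,\dots,v_n$ numbered by its canonical ordering $\psi$ ($\psi(v_i)=i$), let $\mathcal{A}_<=\{\psi(v): h(v)<h(v_n)\}$, and let $\overline{w}=\mathrm{child}_\psi(v_n)$. Let $w$ be any decreasing word over $\mathcal{A}_<$ with $w>_{\mathrm{lex}}\overline{w}$. If a new vertex $v_{n+1}$ is added to $D$ with, for each letter $a$ of $w$, one arc from $v_{n+1}$ to $\psi^{ -1}(a)$ (so that the multiset of children of $v_{n+1}$ corresponds to $w$), then $h(v_{n+1})=h(v_n)$.
   Context: Trees are finite unordered rooted trees. In a directed multigraph, $\mathrm{child}(v)$ is the multiset of heads of arcs leaving $v$ (with multiplicity); the height $h(v)$ is $0$ if $v$ has no children and $1+\max_{u\in\mathrm{child}(v)}h(u)$ otherwise. An irredundant forest is a finite set of trees none of which is isomorphic to a subtree (a vertex together with all its descendants) of another. The DAG reduction $\mathcal{R}(F)$ has one vertex per isomorphism class of subtrees occurring in trees of $F$, with, from the class of $T[v]$ to a class $c'$, as many arcs as $v$ has children $u$ with $T[u]$ in $c'$. An FDAG is a directed acyclic multigraph of the form $\mathcal{R}(F)$ for an irredundant forest $F$; equivalently, a finite connected directed acyclic multigraph in which distinct vertices have distinct multisets of children. Words are finite sequences over a totally ordered alphabet; $<_{\mathrm{lex}}$ is the lexicographical order ($a_0\cdots a_p<_{\mathrm{lex}}b_0\cdots b_q$ iff either there is $k\le\min(p,q)$ with $a_i=b_i$ for $i<k$ and $a_k<b_k$, or the first is a proper prefix of the second); a word $a_0\cdots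 a_m$ is decreasing if $a_i\ge a_{i+1}$ for all $i$. For a bijection $\psi$ from vertices to $\{0,\dots,\#D-1\}$, $\mathrm{child}_\psi(v)$ is the word listing $\psi(w)$, $w\in\mathrm{child}(v)$ (with multiplicity), in non-increasing order. The canonical ordering of an FDAG $D$ is the unique bijection $\psi:V(D)\to\{0,\dots,\#D-1\}$ such that $\psi(u)>\psi(v)$ whenever there is an arc $u\to v$, $h(u)>h(v)\Rightarrow\psi(u)>\psi(v)$, and ($h(u)=h(v)$ and $\mathrm{child}_\psi(u)>_{\mathrm{lex}}\mathrm{child}_\psi(v)$) $\Rightarrow\psi(u)>\psi(v)$. -}

module Defs where

open import Data.Nat using (ℕ; zero; suc; _≤_) renaming (_<_ to _<ℕ_)
open import Data.Nat.Properties using (≤-decTotalOrder)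
open import Data.Fin using (Fin; zero; suc; toℕ; fromℕ; inject₁) renaming (_<_ to _<F_)
open import Data.List using (List; []; _∷_; map; reverse)
open import Data.List.Sort ≤-decTotalOrder using (sort)
open import Data.List.Membership.Propositional using (_∈_)
open import Data.List.Relation.Unary.All using (All)
open import Data.List.Relation.Unary.Any using (Any)
open import Data.List.Relation.Unary.Linked using (Linked)
open import Data.List.Relation.Binary.Permutation.Propositional using (_↭_)
open import Data.List.Relation.Binary.Lex.Core using (Lex-<)
open import Data.Maybe using (Maybe; just; nothing; maybe)
import Data.Maybe as Maybe
open import Data.Product using (∃; ∃₂; _×_)
open import Relation.Binary.PropositionalEquality using (_≡_)
open import Relation.Nullary using (¬_)
open import Relation.Binary.Construct.Closure.Transitive using (TransClosure)
open import Relation.Binary.Construct.Closure.Equivalence using (EqClosure)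

-- A finite directed multigraph on the vertex set Fin k is given by
-- its child function: child v is the multiset of heads of arcs leaving v,
-- represented as a list (multiplicity = number of occurrences; order irrelevant).
Children : ℕ → Set
Children k = Fin k → List (Fin k)

Arc : ∀ {k} → Children k → Fin k → Fin k → Set
Arc c u v = v ∈ c u

Acyclic : ∀ {k} → Children k → Set
Acyclic c = ∀ v → ¬ TransClosure (Arc c) v v

Connected : ∀ {k} → Children k → Set
Connected c = ∀ u v → EqClosure (Arc c) u v

DistinctChildren : ∀ {k} → Children k → Set
DistinctChildren c = ∀ u v → c u ↭ c v → u ≡ v

IsFDAG : ∀ {k} → Children k → Set
IsFDAG c = Acyclic c × Connected c × DistinctChildren c

data Height {k} (c : Children k) : Fin k → ℕ → Set where
  leaf : ∀ {v} → c v ≡ [] → Height c v 0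
  node : ∀ {v m} →
         All (λ u → ∃ λ j → Height c u j × j ≤ m) (c v) →
         Any (λ u → Height c u m) (c v) →
         Height c v (suc m)

-- the lexicographic strict order on words over ℕ (proper prefix is smaller)
_<lex_ : List ℕ → List ℕ → Set
_<lex_ = Lex-< _≡_ _<ℕ_

Decreasing : List ℕ → Set
Decreasing = Linked (λ a b → b ≤ a)

-- child_ψ(v) for ψ = the numbering Fin k → {0..k-1} given by toℕ:
-- the ψ-values of the children, listed in non-increasing order
childψ : ∀ {k} → Children k → Fin k → List ℕ
childψ c v = reverse (sort (map toℕ (c v)))

-- The numbering ψ(v) = toℕ v is the canonical ordering of c
-- (the canonical ordering is the unique bijection with these properties).
IsCanonical : ∀ {k} → Children k → Set
IsCanonical c =
  (∀ u v → Arc c u v → v <F u) ×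
  (∀ u v hu hv → Height c u hu → Height c v hv → hv <ℕ hu → v <F u) ×
  (∀ u v h → Height c u h → Height c v h → childψ c v <lex childψ c u → v <F u)

-- decomposition of Fin (suc m): nothing for the last element fromℕ m,
-- just j for inject₁ j
lastView : ∀ {m} → Fin (suc m) → Maybe (Fin m)
lastView {zero} zero = nothing
lastView {suc m} zero = just zero
lastView {suc m} (suc i) = Maybe.map suc (lastView i)

-- D extended by a new vertex v_{n+1} (index fromℕ (suc n)) with one arc
-- to each letter of w; old vertex i becomes inject₁ i with unchanged arcs.
extend : ∀ {n} → Children (suc n) → List (Fin (suc n)) → Children (suc (suc n))
extend c w i = maybe (λ j → map inject₁ (c j)) (map inject₁ w) (lastView i)

-- Let v = v_n and let a be the first letter of w.  The first letter of childψ(v) is its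
-- largest, and w >lex childψ(v) bounds it by a, so ψ(u) ≤ ψ(a) for every child u of v.  A
-- canonical ordering never numbers a lower vertex above a higher one, hence h(u) ≤ h(a); as
-- some child has height h(v) − 1 and h(a) < h(v), we get h(a) = h(v) − 1.  All letters of w
-- lie below h(v), so h(v_{n+1}) = 1 + h(a) = h(v).

module Submission where

open import Defs
open import Data.Nat using (ℕ; zero; suc; _≥_) renaming (_<_ to _<ℕ_; _≤_ to _≤ℕ_)
open import Data.Nat.Properties using (≤-decTotalOrder; ≤-antisym; ≤-refl; ≤-trans; ≤-pred; <⇒≤; <⇒≱; ≮⇒≥)
open import Data.Fin using (Fin; zero; suc; toℕ; fromℕ; inject₁)
open import Data.List using (List; []; _∷_; map; reverse)
open import Data.List.Properties using (unfold-reverse)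
open import Data.List.Relation.Unary.All as All using (All; []; _∷_)
open import Data.List.Relation.Unary.All.Properties as All using ()
open import Data.List.Relation.Unary.Any using (Any; here; there)
open import Data.List.Relation.Unary.AllPairs using (AllPairs; []; _∷_)
import Data.List.Relation.Unary.AllPairs.Properties as AllPairs
open import Data.List.Relation.Unary.Linked.Properties using (Linked⇒AllPairs)
open import Data.List.Relation.Binary.Lex.Strict using (this; next; halt; xs≮[])
open import Data.List.Relation.Binary.Permutation.Propositional using (_↭_; ↭-sym; ↭-trans)
open import Data.List.Relation.Binary.Permutation.Propositional.Properties using (All-resp-↭; ↭-reverse)
open import Data.List.Membership.Propositional using (find)
open import Data.List.Sort ≤-decTotalOrder using (sort-↭; sort-↗)
open import Data.Maybe using (just; nothing)
open import Data.Product using (∃; ∃₂; _×_; _,_)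
open import Data.Empty using (⊥; ⊥-elim)
open import Function using (flip)
open import Relation.Binary.PropositionalEquality using (_≡_; refl; sym; cong; subst; trans)

AllPairs-reverse⁺ : ∀ {A : Set} {R : A → A → Set} {xs} →
                    AllPairs R xs → AllPairs (flip R) (reverse xs)
AllPairs-reverse⁺ [] = []
AllPairs-reverse⁺ {xs = x ∷ xs} (Rx ∷ Rxs) rewrite unfold-reverse x xs =
  AllPairs.++⁺ (AllPairs-reverse⁺ Rxs) ([] ∷ [])
               (All.map (_∷ []) (All-resp-↭ (↭-sym (↭-reverse xs)) Rx))

descending-<lex-∷⇒All≤ : ∀ {xs a as} → AllPairs _≥_ xs → xs <lex (a ∷ as) → All (_≤ℕ a) xs
descending-<lex-∷⇒All≤ [] halt = []
descending-<lex-∷⇒All≤ (z≥xs ∷ _) (this z<a) = <⇒≤ z<a ∷ All.map (λ y≤z → ≤-trans y≤z (<⇒≤ z<a)) z≥xs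
descending-<lex-∷⇒All≤ (z≥xs ∷ _) (next refl _) = ≤-refl ∷ z≥xs

module _ {k} {c : Children k} where

  childψ-↭ : ∀ v → childψ c v ↭ map toℕ (c v)
  childψ-↭ v = ↭-trans (↭-reverse _) (sort-↭ _)

  childψ-descending : ∀ v → AllPairs _≥_ (childψ c v)
  childψ-descending v = AllPairs-reverse⁺ (Linked⇒AllPairs ≤-trans (sort-↗ _))

  childψ-<lex-∷⇒children≤ : ∀ {v a as} → childψ c v <lex (a ∷ as) → All (λ u → toℕ u ≤ℕ a) (c v)
  childψ-<lex-∷⇒children≤ {v} lx =
    All.map⁻ (All-resp-↭ (childψ-↭ v) (descending-<lex-∷⇒All≤ (childψ-descending v) lx))

  childless-Any : ∀ {v} {P : Fin k → Set} → c v ≡ [] → Any P (c v) → ⊥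
  childless-Any {P = P} e p with subst (Any P) e p
  ... | ()

  mutual
    height-unique : ∀ {v h h′} → Height c v h → Height c v h′ → h ≡ h′
    height-unique (leaf _)   (leaf _)    = refl
    height-unique (leaf e)   (node _ p′) = ⊥-elim (childless-Any e p′)
    height-unique (node _ p) (leaf e)    = ⊥-elim (childless-Any e p)
    height-unique (node q p) (node q′ p′) =
      cong suc (≤-antisym (Any-height≤bound p q′) (Any-height≤bound p′ q))

    Any-height≤bound : ∀ {xs m m′} → Any (λ u → Height c u m) xs →
                       All (λ u → ∃ λ j → Height c u j × j ≤ℕ m′) xs → m ≤ℕ m′
    Any-height≤bound (here hu)  ((_ , hu′ , j≤m′) ∷ _) = subst (_≤ℕ _) (sym (height-unique hu hu′)) j≤m′
    Any-height≤bound (there p) (_ ∷ q) = Any-height≤bound p q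

  canonical⇒height-mono : IsCanonical c → ∀ {u v hu hv} → Height c u hu → Height c v hv →
                          toℕ u ≤ℕ toℕ v → hu ≤ℕ hv
  canonical⇒height-mono (_ , byHeight , _) {u} {v} {hu} {hv} Hu Hv u≤v =
    ≮⇒≥ (λ hv<hu → <⇒≱ (byHeight u v hu hv Hu Hv hv<hu) u≤v)

lastView-fromℕ : ∀ m → lastView (fromℕ m) ≡ nothing
lastView-fromℕ zero    = refl
lastView-fromℕ (suc m) rewrite lastView-fromℕ m = refl

lastView-inject₁ : ∀ {m} (j : Fin m) → lastView (inject₁ j) ≡ just j
lastView-inject₁ {suc m} zero    = refl
lastView-inject₁ {suc m} (suc j) rewrite lastView-inject₁ j = refl

module _ {n} {c : Children (suc n)} {w : List (Fin (suc n))} where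

  extend-inject₁ : ∀ j → extend c w (inject₁ j) ≡ map inject₁ (c j)
  extend-inject₁ j rewrite lastView-inject₁ j = refl

  extend-fromℕ : extend c w (fromℕ (suc n)) ≡ map inject₁ w
  extend-fromℕ rewrite lastView-fromℕ (suc n) = refl

  mutual
    height-extend-inject₁ : ∀ {v h} → Height c v h → Height (extend c w) (inject₁ v) h
    height-extend-inject₁ {v} (leaf e) = leaf (trans (extend-inject₁ v) (cong (map inject₁) e))
    height-extend-inject₁ {v} (node q p) =
      node (subst (All _) (sym (extend-inject₁ v)) (All-height≤-extend q))
           (subst (Any _) (sym (extend-inject₁ v)) (Any-height-extend p))

    All-height≤-extend : ∀ {xs m} → All (λ u → ∃ λ j → Height c u j × j ≤ℕ m) xs →
                         All (λ u → ∃ λ j → Height (extend c w) u j × j ≤ℕ m) (map inject₁ xs)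
    All-height≤-extend [] = []
    All-height≤-extend ((j , hj , j≤m) ∷ q) = (j , height-extend-inject₁ hj , j≤m) ∷ All-height≤-extend q

    Any-height-extend : ∀ {xs m} → Any (λ u → Height c u m) xs →
                        Any (λ u → Height (extend c w) u m) (map inject₁ xs)
    Any-height-extend (here h)  = here (height-extend-inject₁ h)
    Any-height-extend (there p) = there (Any-height-extend p)

  height-extend-fromℕ : ∀ {m} → All (λ a → ∃ λ j → Height c a j × j ≤ℕ m) w →
                        Any (λ a → Height c a m) w → Height (extend c w) (fromℕ (suc n)) (suc m)
  height-extend-fromℕ q p = node (subst (All _) (sym extend-fromℕ) (All-height≤-extend q))
                                 (subst (Any _) (sym extend-fromℕ) (Any-height-extend p))

lemma2p9 : (n : ℕ) (c : Children (suc n)) → IsFDAG c → IsCanonical c →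
    (w : List (Fin (suc n))) →
    All (λ a → ∃₂ λ ha hn → Height c a ha × Height c (fromℕ n) hn × ha <ℕ hn) w →
    Decreasing (map toℕ w) →
    childψ c (fromℕ n) <lex map toℕ w →
    ∃ λ h → Height (extend c w) (fromℕ (suc n)) h × Height (extend c w) (inject₁ (fromℕ n)) h
lemma2p9 n c _ _ [] _ _ lx = ⊥-elim (xs≮[] lx)
lemma2p9 n c _ can (a ∷ as) letters@((ha , _ , Ha , Hv@(node {m = m} _ p) , ha<) ∷ _) _ lx =
  suc m , height-extend-fromℕ (All.map below-v letters) (here Ha-m) , height-extend-inject₁ Hv
  where
  below-v : ∀ {b} → (∃₂ λ hb hn → Height c b hb × Height c (fromℕ n) hn × hb <ℕ hn) →
            ∃ λ j → Height c b j × j ≤ℕ m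
  below-v (hb , _ , Hb , Hn , hb<hn) = hb , Hb , ≤-pred (subst (hb <ℕ_) (height-unique Hn Hv) hb<hn)

  Ha-m : Height c a m
  Ha-m with find p
  ... | u , u∈ , Hu = subst (Height c a) (≤-antisym (≤-pred ha<) m≤ha) Ha
    where
    m≤ha : m ≤ℕ ha
    m≤ha = canonical⇒height-mono can Hu Ha (All.lookup (childψ-<lex-∷⇒children≤ {c = c} lx) u∈)
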